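{- Let $A$ be an algebraic CPO with basis $B$, $C$ a CPO, and $f:B\to C$ monotone. Then $\overline f:A\to C$ is continuous.
   Context: An ordered type is a type with a reflexive transitive relation $\sqsubseteq$. $U:\mathbb{N}\to X$ is directed if $\forall i\,j\,\exists k,\ U\,i\sqsubseteq U\,k\land U\,j\sqsubseteq U\,k$; an $\omega$-chain if $i\le j\Rightarrow U\,i\sqsubseteq U\,j$. A CPO (dCPO) is an ordered type in which every directed $U:\mathbb{N}\to X$ has a supremum; an $\omega$-CPO one in which every $\omega$-chain has a supremum. $h:X\to Y$ is monotone if $x\sqsubseteq y\Rightarrow h\,x\sqsubseteq h\,y$, and continuous if $h(\sup U)=\sup(h\circ U)$ for every directed $U$. $x$ is compact if for every directed $U$ with $\sup U=x$ there is $i$ with $U\,i=x$; a type is compact if all its elements are. For an $\omega$-CPO $A$ and ordered type $B$, $B$ is dense in $A$ if there are continuous $\mathsf{incl}:B\to A$ and $\mathsf{idl}:A\to\mathbb{N}\to B$ with $\mathsf{idl}\,a$ an $\omega$-chain and $\sup(\mathsf{incl}\circ\mathsf{idl}\,a)=a$ for all $a$. $A$ is an algebraic CPO with basis $B$ if $B$ is compact and dense in $A$. For monotone $f:B\to C$, $\overline f(a):=\sup_i f(\mathsf{idl}\,a\,i)$ (supremum chosen by choice). -}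

module Defs where

open import Level using (Level; _⊔_) renaming (suc to lsuc)
open import Data.Nat using (ℕ; _≤_) renaming (_⊔_ to _⊔ℕ_)
open import Data.Nat.Properties using (m≤m⊔n; m≤n⊔m)
open import Data.Product using (Σ; ∃; _×_; _,_; proj₁; proj₂)
open import Function using (_∘_)
open import Relation.Binary.PropositionalEquality using (_≡_)

record Ordered (a ℓ : Level) : Set (lsuc (a ⊔ ℓ)) where
  field
    Carrier : Set a
    _⊑_     : Carrier → Carrier → Set ℓ
    ⊑-refl  : ∀ {x} → x ⊑ x
    ⊑-trans : ∀ {x y z} → x ⊑ y → y ⊑ z → x ⊑ z

module _ {a ℓ : Level} (X : Ordered a ℓ) where
  open Ordered X

  Directed : (ℕ → Carrier) → Set ℓ
  Directed U = ∀ i j → ∃ λ k → (U i ⊑ U k) × (U j ⊑ U k)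

  OmegaChain : (ℕ → Carrier) → Set ℓ
  OmegaChain U = ∀ {i j} → i ≤ j → U i ⊑ U j

  IsUpperBound : (ℕ → Carrier) → Carrier → Set ℓ
  IsUpperBound U x = ∀ i → U i ⊑ x

  IsSup : (ℕ → Carrier) → Carrier → Set (a ⊔ ℓ)
  IsSup U x = IsUpperBound U x × (∀ y → IsUpperBound U y → x ⊑ y)

  Compact : Carrier → Set (a ⊔ ℓ)
  Compact x = ∀ U → Directed U → IsSup U x → ∃ λ i → U i ≡ x

  CompactType : Set (a ⊔ ℓ)
  CompactType = ∀ x → Compact x

  chain⇒directed : ∀ {U} → OmegaChain U → Directed U
  chain⇒directed c i j = (i ⊔ℕ j) , c (m≤m⊔n i j) , c (m≤n⊔m i j)

SeqOrd : {a ℓ : Level} → Ordered a ℓ → Ordered a ℓ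
SeqOrd X = record
  { Carrier = ℕ → Carrier
  ; _⊑_     = λ u v → ∀ i → u i ⊑ v i
  ; ⊑-refl  = λ i → ⊑-refl
  ; ⊑-trans = λ p q i → ⊑-trans (p i) (q i)
  }
  where open Ordered X

record CPO (a ℓ : Level) : Set (lsuc (a ⊔ ℓ)) where
  field
    ord       : Ordered a ℓ
  open Ordered ord public
  field
    sup       : (U : ℕ → Carrier) → Directed ord U → Carrier
    sup-isSup : ∀ U (d : Directed ord U) → IsSup ord U (sup U d)

record ωCPO (a ℓ : Level) : Set (lsuc (a ⊔ ℓ)) where
  field
    ord       : Ordered a ℓ
  open Ordered ord public
  field
    sup       : (U : ℕ → Carrier) → OmegaChain ord U → Carrier
    sup-isSup : ∀ U (c : OmegaChain ord U) → IsSup ord U (sup U c)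

module _ {a ℓ b ℓ' : Level} (X : Ordered a ℓ) (Y : Ordered b ℓ') where
  private
    module X = Ordered X
    module Y = Ordered Y

  Monotone : (X.Carrier → Y.Carrier) → Set (a ⊔ ℓ ⊔ ℓ')
  Monotone h = ∀ {x y} → x X.⊑ y → h x Y.⊑ h y

  Continuous : (X.Carrier → Y.Carrier) → Set (a ⊔ ℓ ⊔ b ⊔ ℓ')
  Continuous h = ∀ U → Directed X U → ∀ x → IsSup X U x → IsSup Y (h ∘ U) (h x)

record Dense {a ℓ b ℓ' : Level} (A : ωCPO a ℓ) (B : Ordered b ℓ')
       : Set (a ⊔ ℓ ⊔ b ⊔ ℓ') where
  private
    module A = ωCPO A
    module B = Ordered B
  field
    incl      : B.Carrier → A.Carrier
    idl       : A.Carrier → ℕ → B.Carrier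
    incl-cont : Continuous B A.ord incl
    idl-cont  : Continuous A.ord (SeqOrd B) idl
    idl-chain : ∀ x → OmegaChain B (idl x)
    idl-sup   : ∀ x → IsSup A.ord (incl ∘ idl x) x

record Algebraic {a ℓ b ℓ' : Level} (A : ωCPO a ℓ) (B : Ordered b ℓ')
       : Set (a ⊔ ℓ ⊔ b ⊔ ℓ') where
  field
    compact : CompactType B
    dense   : Dense A B

extend : ∀ {a ℓ b ℓ' c ℓ''} (A : ωCPO a ℓ) (B : Ordered b ℓ') (C : CPO c ℓ'')
       → Dense A B → (f : Ordered.Carrier B → CPO.Carrier C)
       → Monotone B (CPO.ord C) f → ωCPO.Carrier A → CPO.Carrier C
extend A B C D f fm x =
  CPO.sup C (f ∘ Dense.idl D x)
    (chain⇒directed (CPO.ord C) (λ i≤j → fm (Dense.idl-chain D x i≤j)))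

-- The approximants idl x i of a supremum x = sup U are compact, and since idl is
-- continuous they are suprema of the directed columns idl (U n) i; compactness
-- then says each idl x i already equals some idl (U n) i.  Hence every
-- f (idl x i) lies below f̄ (U n) for some n, so f̄ x = sup_i f (idl x i) is
-- below every upper bound of f̄ ∘ U, while f̄ ∘ U ⊑ f̄ x by monotonicity.
module Submission where

open import Defs
open import Level using (Level)
open import Data.Nat using (ℕ; zero; suc; _≟_)
open import Data.Product using (∃; _,_; proj₁; proj₂)
open import Function using (_∘_)
open import Relation.Nullary using (yes; no)
open import Relation.Nullary.Negation using (contradiction)
open import Relation.Binary.PropositionalEquality using (_≡_; refl; subst)

module _ {a ℓ : Level} (X : Ordered a ℓ) where
  open Ordered X

  _◂_ : Carrier → Carrier → ℕ → Carrier
  (u ◂ v) zero    = u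
  (u ◂ v) (suc _) = v

  ◂-directed : ∀ {u v} → u ⊑ v → Directed X (u ◂ v)
  ◂-directed {u} {v} u⊑v i j = 1 , below i , below j
    where
    below : ∀ k → (u ◂ v) k ⊑ v
    below zero    = u⊑v
    below (suc _) = ⊑-refl

  ◂-isSup : ∀ {u v} → u ⊑ v → IsSup X (u ◂ v) v
  ◂-isSup u⊑v = (λ k → proj₁ (proj₂ (◂-directed u⊑v k k))) , λ _ ub → ub 1

  updateAt : (ℕ → Carrier) → ℕ → Carrier → ℕ → Carrier
  updateAt s i z j with j ≟ i
  ... | yes _ = z
  ... | no  _ = s j

  updateAt-≡ : ∀ s i z → updateAt s i z i ≡ z
  updateAt-≡ s i z with i ≟ i
  ... | yes _  = refl
  ... | no i≢i = contradiction refl i≢i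

  SeqOrd-isSup⇒isSup : ∀ {U s} → IsSup (SeqOrd X) U s →
                       ∀ i → IsSup X (λ n → U n i) (s i)
  SeqOrd-isSup⇒isSup {U} {s} (s-ub , s-least) i =
    (λ n → s-ub n i) ,
    λ z z-ub → subst (s i ⊑_) (updateAt-≡ s i z)
                     (s-least (updateAt s i z) (updated-ub z z-ub) i)
    where
    updated-ub : ∀ z → IsUpperBound X (λ n → U n i) z →
                 IsUpperBound (SeqOrd X) U (updateAt s i z)
    updated-ub z z-ub n j with j ≟ i
    ... | yes refl = z-ub n
    ... | no  _    = s-ub n j

module _ {a ℓ b ℓ' : Level} (X : Ordered a ℓ) (Y : Ordered b ℓ') where
  Continuous⇒Monotone : ∀ {h} → Continuous X Y h → Monotone X Y h
  Continuous⇒Monotone {h} h-cont {u} {v} u⊑v =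
    proj₁ (h-cont (_◂_ X u v) (◂-directed X u⊑v) v (◂-isSup X u⊑v)) 0

  Directed-map : ∀ {h U} → Monotone X Y h → Directed X U → Directed Y (h ∘ U)
  Directed-map h-mono U-dir i j with U-dir i j
  ... | k , Ui⊑Uk , Uj⊑Uk = k , h-mono Ui⊑Uk , h-mono Uj⊑Uk

module _ {a ℓ b ℓ' : Level} {A : ωCPO a ℓ} {B : Ordered b ℓ'} (D : Dense A B) where
  private
    module A = ωCPO A
    module B = Ordered B
  open Dense D

  idl-monotone : ∀ {u v} → u A.⊑ v → ∀ i → idl u i B.⊑ idl v i
  idl-monotone = Continuous⇒Monotone A.ord (SeqOrd B) idl-cont

  idl-column-isSup : ∀ {U x} → Directed A.ord U → IsSup A.ord U x →
                     ∀ i → IsSup B (λ n → idl (U n) i) (idl x i)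
  idl-column-isSup {U} {x} U-dir x-sup = SeqOrd-isSup⇒isSup B (idl-cont U U-dir x x-sup)

  idl-column-directed : ∀ {U} → Directed A.ord U → ∀ i → Directed B (λ n → idl (U n) i)
  idl-column-directed U-dir i = Directed-map A.ord B (λ u⊑v → idl-monotone u⊑v i) U-dir

  idl-sup-reached : CompactType B → ∀ {U x} → Directed A.ord U → IsSup A.ord U x →
                    ∀ i → ∃ λ n → idl (U n) i ≡ idl x i
  idl-sup-reached compact U-dir x-sup i =
    compact _ _ (idl-column-directed U-dir i) (idl-column-isSup U-dir x-sup i)

module _ {a ℓ b ℓ' c ℓ'' : Level} {A : ωCPO a ℓ} {B : Ordered b ℓ'} (C : CPO c ℓ'')
         (D : Dense A B) {f : Ordered.Carrier B → CPO.Carrier C}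
         (f-mono : Monotone B (CPO.ord C) f) where
  private
    module A = ωCPO A
    module C = CPO C
    f̄ = extend A B C D f f-mono
  open Dense D

  extend-isSup : ∀ x → IsSup C.ord (f ∘ idl x) (f̄ x)
  extend-isSup x = C.sup-isSup (f ∘ idl x)
    (chain⇒directed C.ord (λ i≤j → f-mono (idl-chain x i≤j)))

  extend-monotone : Monotone A.ord C.ord f̄
  extend-monotone {u} {v} u⊑v = proj₂ (extend-isSup u) (f̄ v)
    λ i → C.⊑-trans (f-mono (idl-monotone D u⊑v i)) (proj₁ (extend-isSup v) i)

  extend-continuous : CompactType B → Continuous A.ord C.ord f̄
  extend-continuous compact U U-dir x x-sup =
    (λ n → extend-monotone (proj₁ x-sup n)) , least
    where
    least : ∀ y → IsUpperBound C.ord (f̄ ∘ U) y → f̄ x C.⊑ y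
    least y y-ub = proj₂ (extend-isSup x) y λ i →
      let (n , idl-Un≡idl-x) = idl-sup-reached D compact U-dir x-sup i
      in subst (λ b → f b C.⊑ y) idl-Un≡idl-x
               (C.⊑-trans (proj₁ (extend-isSup (U n)) i) (y-ub n))

mainTheorem13 : ∀ {a ℓ b ℓ' c ℓ''}
    (A : ωCPO a ℓ) (B : Ordered b ℓ') (C : CPO c ℓ'')
    (alg : Algebraic A B)
    (f : Ordered.Carrier B → CPO.Carrier C) (fm : Monotone B (CPO.ord C) f) →
    Continuous (ωCPO.ord A) (CPO.ord C) (extend A B C (Algebraic.dense alg) f fm)
mainTheorem13 A B C alg f fm = extend-continuous C dense fm compact
  where open Algebraic alg
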